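{- Let $D=(V,A)$ be a digraph, $(V_1,\dots,V_t)$ a partition of $V$, and $s\geq 0$, $k\geq s+2$ integers. Let $h\in[t]$ be such that for every $p\leq h$ and every $u\in V_p$ there exists $X_u\subseteq\bigcup_{i=p+1}^tV_i$ with $|X_u|\leq s$ such that $X_u$ intersects every directed cycle containing $u$ in $D-\bigcup_{i=1}^{p-1}V_i$. Then for every $k$-dicolouring $\alpha$ of $D$ and every colour $c\in[s+2]$, there exists a redicolouring sequence from $\alpha$ to some $k$-dicolouring $\beta$ such that: for every $v\in\bigcup_{i=1}^hV_i$, $\beta(v)\neq c$ and $\beta(v)\leq s+2$; no vertex of $\bigcup_{i=h+1}^tV_i$ is recoloured; and each vertex of $\bigcup_{i=1}^hV_i$ is recoloured at most $f(s,h)$ times, where $f(s,t)=(s+1)!(2t)^s$.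
   Context: A $k$-dicolouring of $D$ is a map $V\to[k]$ whose colour classes induce acyclic subdigraphs. A redicolouring sequence is a sequence of $k$-dicolourings in which consecutive dicolourings differ on the colour of exactly one vertex (i.e., a path in the $k$-dicolouring graph); a vertex is recoloured once at each step where its colour changes. -}

module Defs where

open import Data.Nat using (ℕ; zero; suc; _+_; _*_; _^_; _≤_; _<_; _!)

open import Data.Bool using (Bool; true; false; T)
open import Data.Fin using (Fin; toℕ)
open import Data.Fin.Properties using (_≟_)
open import Data.List using (List; []; _∷_)
open import Data.List.Relation.Unary.All using (All)
open import Data.List.Relation.Unary.Unique.Propositional using (Unique)
open import Data.Product using (_×_; ∃)
open import Data.Empty using (⊥)
open import Relation.Nullary using (¬_; yes; no)
open import Relation.Binary.PropositionalEquality using (_≡_; _≢_)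

-- A (loopless) digraph on vertex set Fin n; digons are allowed.
record Digraph (n : ℕ) : Set where
  field
    arc      : Fin n → Fin n → Bool
    loopless : ∀ v → arc v v ≡ false

open Digraph public

Arc : ∀ {n} → Digraph n → Fin n → Fin n → Set
Arc D x y = T (arc D x y)

Chain : ∀ {n} → Digraph n → Fin n → List (Fin n) → Fin n → Set
Chain D x []       y = Arc D x y
Chain D x (z ∷ zs) y = Arc D x z × Chain D z zs y

IsDirCycle : ∀ {n} → Digraph n → List (Fin n) → Set
IsDirCycle D []       = ⊥
IsDirCycle D (x ∷ xs) = Unique (x ∷ xs) × Chain D x xs x

-- Colourings with colours Fin k (colour i ∈ Fin k stands for colour i+1 ∈ [k]).
Colouring : ℕ → ℕ → Set
Colouring n k = Fin n → Fin k

IsDicolouring : ∀ {n k} → Digraph n → Colouring n k → Set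
IsDicolouring {n} {k} D α =
  ∀ (c : Fin k) (C : List (Fin n)) → IsDirCycle D C → ¬ All (λ v → α v ≡ c) C

OneStep : ∀ {n k} → Colouring n k → Colouring n k → Set
OneStep {n} α β = ∃ λ (v : Fin n) → α v ≢ β v × (∀ w → w ≢ v → α w ≡ β w)

-- Redicolouring sequence from α to β (each new colouring is a k-dicolouring;
-- the first one, α, is assumed to be a k-dicolouring separately).
data Redicolouring {n k} (D : Digraph n) : Colouring n k → Colouring n k → Set where
  done : ∀ {α} → Redicolouring D α α
  step : ∀ {α β γ} → OneStep α β → IsDicolouring D β →
         Redicolouring D β γ → Redicolouring D α γ

recolourings : ∀ {n k} {D : Digraph n} {α β : Colouring n k} →
               Fin n → Redicolouring D α β → ℕ
recolourings v done = 0
recolourings v (step {α} {β} _ _ r) with α v ≟ β v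
... | yes _ = recolourings v r
... | no  _ = suc (recolourings v r)

f : ℕ → ℕ → ℕ
f s t = (suc s) ! * (2 * t) ^ s

-- The level of a vertex is the index of its part, and X_u meets every cycle
-- through u at levels ≥ level u. Induct on s and, for fixed s, on h, with a
-- palette c ∷ ps of s + 2 distinct colours where c is the colour to avoid; a set Z
-- of frozen vertices, coloured outside the palette, is treated as deleted from D,
-- and the vertices below level h outside Z are active. For s = 0 the transversals
-- are empty, so no cycle of D - Z meets an active vertex, and each active vertex
-- is recoloured once, to the single colour of ps. For s + 1 pick d ∈ ps. By
-- induction on h, first colour the active vertices below level h - 1 from
-- c ∷ ps ∖ d. Then, level by level from h - 1 down to 0, recolour an active vertex
-- u with d unless u or a vertex of X_u already has colour d: a monochromatic cycle
-- so created would either stay at levels ≥ level u, and then meet X_u, or meet a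
-- lower active vertex, which is not coloured d. Now every active vertex is
-- coloured d or has X_u meeting the colour class of d, so freezing that class
-- makes every transversal smaller, and the case s recolours the remaining active
-- vertices from ps ∖ d. So a vertex is recoloured at most b(s, h) times, where
-- b = recolourBound satisfies b(s + 1, h + 1) = b(s + 1, h) + 1 + b(s, h + 1) and
-- b ≤ f.

module Submission where

open import Defs
open import Data.Nat using (ℕ; zero; suc; pred; _+_; _*_; _^_; _≤_; _<_; _≤?_; _<?_; z≤n; s≤s; _!)
open import Data.Nat.Properties hiding (_≟_)
open import Data.Nat.Properties using () renaming (_≟_ to _≟ℕ_)
open import Data.Nat.Tactic.RingSolver using (solve-∀)
open import Data.Bool using (true; false)
open import Data.Fin using (Fin; toℕ; inject≤; fromℕ<; punchIn) renaming (zero to fzero; suc to fsuc)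
open import Data.Fin.Properties
  using (_≟_; toℕ-injective; toℕ-inject≤; toℕ-fromℕ<; toℕ<n; inject≤-injective; punchIn-injective;
         punchInᵢ≢i)
open import Data.Fin.Subset using (Subset; _∈_; ∣_∣)
open import Data.Vec using ([]; _∷_; here; there)
open import Data.List using (List; []; _∷_; length; map; filter; tabulate; allFin)
open import Data.List.Properties using (length-map; length-tabulate; filter-notAll)
open import Data.List.Relation.Unary.All as All using (All; []; _∷_)
open import Data.List.Relation.Unary.All.Properties as AllP using (All¬⇒¬Any; ¬All⇒Any¬)
open import Data.List.Relation.Unary.Any as Any using (Any; here; there)
open import Data.List.Relation.Unary.AllPairs as AllPairs using ([]; _∷_)
open import Data.List.Relation.Unary.Unique.Propositional using (Unique)
import Data.List.Relation.Unary.Unique.Propositional.Properties as Unique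
open import Data.List.Relation.Binary.Subset.Propositional using (_⊆_)
open import Data.List.Relation.Binary.Subset.Propositional.Properties using (∷⁺ʳ; xs⊆x∷xs)
open import Data.List.Relation.Binary.Permutation.Propositional using (↭-swap; ↭-refl)
open import Data.List.Relation.Binary.Permutation.Propositional.Properties using (∈-resp-↭)
open import Data.List.Membership.Propositional using (find; lose) renaming (_∈_ to _∈ₗ_)
open import Data.List.Membership.Propositional.Properties
  using (∈-allFin; ∈-map⁺; ∈-map⁻; ∈-filter⁺; ∈-tabulate⁻; ∈-length)
open import Data.List.Extrema.Nat using (argmin; argmin-sel; f[argmin]≤f[⊤]; f[argmin]≤f[xs])
open import Data.Product using (_×_; _,_; proj₁; proj₂; ∃; Σ)
open import Data.Sum using (_⊎_; inj₁; inj₂; [_,_])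
open import Data.Empty using (⊥)
open import Function using (_∘_)
open import Relation.Nullary using (¬_; Dec; yes; no; contradiction)
open import Relation.Nullary.Decidable using (_⊎-dec_; _×-dec_; ¬?)
open import Relation.Unary using (Decidable)
open import Relation.Binary.PropositionalEquality using (_≡_; _≢_; refl; sym; trans; cong; cong₂; subst)

recolourBound : ℕ → ℕ → ℕ
recolourBound zero    h       = 1
recolourBound (suc s) zero    = 0
recolourBound (suc s) (suc h) = recolourBound (suc s) h + 1 + recolourBound s (suc h)

f-recurrence : ∀ s h → f (suc s) h + 1 + f s (suc h) ≤ f (suc s) (suc h)
f-recurrence s h = begin
    M * K * (a * a ^ s) + 1 + K * y
  ≤⟨ +-monoˡ-≤ (K * y) (+-mono-≤ (*-monoʳ-≤ (M * K) (*-monoʳ-≤ a (^-monoˡ-≤ s a≤b))) 1≤Ky) ⟩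
    M * K * (a * y) + K * y + K * y
  ≤⟨ +-mono-≤ (+-monoʳ-≤ (M * K * (a * y)) (m≤n*m (K * y) M)) (m≤n*m (K * y) M) ⟩
    M * K * (a * y) + M * (K * y) + M * (K * y)
  ≡⟨ collect M K a y ⟩
    M * K * ((2 + a) * y)
  ≡⟨ cong (λ x → M * K * (x * y)) (sym (*-suc 2 h)) ⟩
    M * K * (b * y)
  ∎
  where
  open ≤-Reasoning
  M = suc (suc s)
  K = suc s !
  a = 2 * h
  b = 2 * suc h
  y = b ^ s
  a≤b : a ≤ b
  a≤b = *-monoʳ-≤ 2 (n≤1+n h)
  1≤Ky : 1 ≤ K * y
  1≤Ky = *-mono-≤ (1≤n! (suc s)) (m^n>0 b s)
  collect : ∀ M K a y → M * K * (a * y) + M * (K * y) + M * (K * y) ≡ M * K * ((2 + a) * y)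
  collect = solve-∀

recolourBound≤f : ∀ s h → recolourBound s h ≤ f s h
recolourBound≤f zero    h       = s≤s z≤n
recolourBound≤f (suc s) zero    = z≤n
recolourBound≤f (suc s) (suc h) =
  ≤-trans (+-mono-≤ (+-monoˡ-≤ 1 (recolourBound≤f (suc s) h)) (recolourBound≤f s (suc h)))
          (f-recurrence s h)

toList : ∀ {m} → Subset m → List (Fin m)
toList []          = []
toList (true  ∷ X) = fzero ∷ map fsuc (toList X)
toList (false ∷ X) = map fsuc (toList X)

length-toList : ∀ {m} (X : Subset m) → length (toList X) ≡ ∣ X ∣
length-toList []          = refl
length-toList (true  ∷ X) = cong suc (trans (length-map fsuc (toList X)) (length-toList X))
length-toList (false ∷ X) = trans (length-map fsuc (toList X)) (length-toList X)

∈-toList⁻ : ∀ {m} (X : Subset m) {x} → x ∈ₗ toList X → x ∈ X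
∈-toList⁻ (true ∷ X) (here refl) = here
∈-toList⁻ (true ∷ X) (there x∈) with ∈-map⁻ fsuc x∈
... | _ , y∈ , refl = there (∈-toList⁻ X y∈)
∈-toList⁻ (false ∷ X) x∈ with ∈-map⁻ fsuc x∈
... | _ , y∈ , refl = there (∈-toList⁻ X y∈)

∈-toList⁺ : ∀ {m} (X : Subset m) {x} → x ∈ X → x ∈ₗ toList X
∈-toList⁺ (true  ∷ X) here      = here refl
∈-toList⁺ (true  ∷ X) (there x∈) = there (∈-map⁺ fsuc (∈-toList⁺ X x∈))
∈-toList⁺ (false ∷ X) (there x∈) = ∈-map⁺ fsuc (∈-toList⁺ X x∈)

module _ {m k : ℕ} (m<k : suc m ≤ k) (c : Fin k) (c<1+m : toℕ c < suc m) where

  private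
    c′ = fromℕ< c<1+m
    colour : Fin m → Fin k
    colour i = inject≤ (punchIn c′ i) m<k

  otherColours : List (Fin k)
  otherColours = tabulate colour

  length-otherColours : length otherColours ≡ m
  length-otherColours = length-tabulate colour

  otherColours-unique : Unique (c ∷ otherColours)
  otherColours-unique =
    AllP.tabulate⁺ (λ i c≡ → punchInᵢ≢i c′ i
                     (sym (inject≤-injective m<k m<k c′ (punchIn c′ i) (trans c′≡c c≡))))
    ∷ Unique.tabulate⁺ (λ {i} {j} eq → punchIn-injective c′ i j (inject≤-injective m<k m<k _ _ eq))
    where
    c′≡c : inject≤ c′ m<k ≡ c
    c′≡c = toℕ-injective (trans (toℕ-inject≤ c′ m<k) (toℕ-fromℕ< c<1+m))

  otherColours-< : ∀ {x} → x ∈ₗ otherColours → toℕ x < suc m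
  otherColours-< x∈ with ∈-tabulate⁻ {f = colour} x∈
  ... | i , refl = subst (_< suc m) (sym (toℕ-inject≤ (punchIn c′ i) m<k)) (toℕ<n (punchIn c′ i))

module Sequences {n k : ℕ} (D : Digraph n) where

  Col : Set
  Col = Colouring n k

  private
    variable
      α β γ δ : Col
      v w : Fin n
      e : Fin k

  _◅◅_ : Redicolouring D α β → Redicolouring D β γ → Redicolouring D α γ
  done          ◅◅ r′ = r′
  step o dic r  ◅◅ r′ = step o dic (r ◅◅ r′)

  recolourings-◅◅ : ∀ v (r : Redicolouring D α β) (r′ : Redicolouring D β γ) →
                    recolourings v (r ◅◅ r′) ≡ recolourings v r + recolourings v r′
  recolourings-◅◅ v done r′ = refl
  recolourings-◅◅ v (step {α} {β} o dic r) r′ with α v ≟ β v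
  ... | yes _ = recolourings-◅◅ v r r′
  ... | no  _ = cong suc (recolourings-◅◅ v r r′)

  recolourings-◅◅◅ : ∀ v (r₁ : Redicolouring D α β) (r₂ : Redicolouring D β γ)
                     (r₃ : Redicolouring D γ δ) →
    recolourings v ((r₁ ◅◅ r₂) ◅◅ r₃) ≡ recolourings v r₁ + recolourings v r₂ + recolourings v r₃
  recolourings-◅◅◅ v r₁ r₂ r₃ = trans (recolourings-◅◅ v (r₁ ◅◅ r₂) r₃)
                                      (cong (_+ recolourings v r₃) (recolourings-◅◅ v r₁ r₂))

  recolourings≡0⇒fixed : ∀ v (r : Redicolouring D α β) → recolourings v r ≡ 0 → β v ≡ α v
  recolourings≡0⇒fixed v done _ = refl
  recolourings≡0⇒fixed v (step {α} {β} o dic r) r≡0 with α v ≟ β v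
  ... | yes αv≡βv = trans (recolourings≡0⇒fixed v r r≡0) (sym αv≡βv)

  end-isDicolouring : IsDicolouring D α → Redicolouring D α β → IsDicolouring D β
  end-isDicolouring dic done            = dic
  end-isDicolouring _   (step _ dic′ r) = end-isDicolouring dic′ r

  oneStep-changes-only : (o : OneStep α β) → α v ≢ β v → v ≡ proj₁ o
  oneStep-changes-only {v = v} (u , _ , others) αv≢βv with v ≟ u
  ... | yes v≡u = v≡u
  ... | no  v≢u = contradiction (others v v≢u) αv≢βv

  recolour : Col → Fin n → Fin k → Col
  recolour γ u e w with w ≟ u
  ... | yes _ = e
  ... | no  _ = γ w

  recolour-same : ∀ γ u e → recolour γ u e u ≡ e
  recolour-same γ u e with u ≟ u
  ... | yes _   = refl
  ... | no  u≢u = contradiction refl u≢u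

  recolour-other : ∀ γ u e → w ≢ u → recolour γ u e w ≡ γ w
  recolour-other {w} γ u e w≢u with w ≟ u
  ... | yes w≡u = contradiction w≡u w≢u
  ... | no  _   = refl

  recolour-oneStep : ∀ γ u e → γ u ≢ e → OneStep γ (recolour γ u e)
  recolour-oneStep γ u e γu≢e =
    u , (λ eq → γu≢e (trans eq (recolour-same γ u e))) , (λ w w≢u → sym (recolour-other γ u e w≢u))

  recolour-isDicolouring : ∀ γ u e → IsDicolouring D γ →
    (∀ C → IsDirCycle D C → u ∈ₗ C → All (λ w → w ≢ u → γ w ≡ e) C → ⊥) →
    IsDicolouring D (recolour γ u e)
  recolour-isDicolouring γ u e dic no-cycle c C cycle mono with Any.any? (u ≟_) C
  ... | yes u∈C = no-cycle C cycle u∈C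
                    (All.map (λ eq w≢u → trans (sym (recolour-other γ u e w≢u)) (trans eq c≡e)) mono)
    where
    c≡e : c ≡ e
    c≡e = trans (sym (All.lookup mono u∈C)) (recolour-same γ u e)
  ... | no  u∉C = dic c C cycle
                    (All.zipWith (λ (u≢w , eq) → trans (sym (recolour-other γ u e (u≢w ∘ sym))) eq)
                                 (AllP.¬Any⇒All¬ C u∉C , mono))

  data RecoloursTo (S : Fin n → Set) (e : Fin k) : Redicolouring D α β → Set where
    stay : RecoloursTo S e (done {α = α})
    move : {o : OneStep α β} {dic : IsDicolouring D β} {r : Redicolouring D β γ} →
           S (proj₁ o) → β (proj₁ o) ≡ e → RecoloursTo S e r → RecoloursTo S e (step o dic r)

  module _ {S : Fin n → Set} where

    recoloursTo-◅◅ : {r : Redicolouring D α β} {r′ : Redicolouring D β γ} →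
                     RecoloursTo S e r → RecoloursTo S e r′ → RecoloursTo S e (r ◅◅ r′)
    recoloursTo-◅◅ stay          m′ = m′
    recoloursTo-◅◅ (move s eq m) m′ = move s eq (recoloursTo-◅◅ m m′)

    recoloursTo-mono : ∀ {S′} {r : Redicolouring D α β} →
                       (∀ v → S v → S′ v) → RecoloursTo S e r → RecoloursTo S′ e r
    recoloursTo-mono S⊆S′ stay                     = stay
    recoloursTo-mono S⊆S′ (move {o = o} s eq m) = move (S⊆S′ (proj₁ o) s) eq (recoloursTo-mono S⊆S′ m)

    recoloursTo-fixes-e : ∀ {r : Redicolouring D α β} v → RecoloursTo S e r → α v ≡ e → recolourings v r ≡ 0
    recoloursTo-fixes-e v stay _ = refl
    recoloursTo-fixes-e v (move {α} {β} {o = o} _ βu≡e m) αv≡e with α v ≟ β v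
    ... | yes αv≡βv = recoloursTo-fixes-e v m (trans (sym αv≡βv) αv≡e)
    ... | no  αv≢βv with oneStep-changes-only o αv≢βv
    ...   | refl = contradiction (trans αv≡e (sym βu≡e)) αv≢βv

    recoloursTo-keeps-e : ∀ {r : Redicolouring D α β} v → RecoloursTo S e r → α v ≡ e → β v ≡ e
    recoloursTo-keeps-e {r = r} v m αv≡e = trans (recolourings≡0⇒fixed v r (recoloursTo-fixes-e v m αv≡e)) αv≡e

    recoloursTo-≤1 : ∀ {r : Redicolouring D α β} v → RecoloursTo S e r → recolourings v r ≤ 1
    recoloursTo-≤1 v stay = z≤n
    recoloursTo-≤1 v (move {α} {β} {o = o} _ βu≡e m) with α v ≟ β v
    ... | yes _     = recoloursTo-≤1 v m
    ... | no  αv≢βv with oneStep-changes-only o αv≢βv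
    ...   | refl = s≤s (≤-reflexive (recoloursTo-fixes-e v m βu≡e))

    recoloursTo-outside : ∀ {r : Redicolouring D α β} v → RecoloursTo S e r → ¬ S v → recolourings v r ≡ 0
    recoloursTo-outside v stay _ = refl
    recoloursTo-outside v (move {α} {β} {o = o} s _ m) ¬Sv with α v ≟ β v
    ... | yes _     = recoloursTo-outside v m ¬Sv
    ... | no  αv≢βv with oneStep-changes-only o αv≢βv
    ...   | refl = contradiction s ¬Sv

    recoloursTo-fixed-outside : ∀ {r : Redicolouring D α β} v → RecoloursTo S e r → ¬ S v → β v ≡ α v
    recoloursTo-fixed-outside {r = r} v m ¬Sv = recolourings≡0⇒fixed v r (recoloursTo-outside v m ¬Sv)

  module Greedy (e : Fin k) {S : Fin n → Set} (S? : Decidable S)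
    (Inv : Col → Set) (Done : Col → Fin n → Set) (done? : ∀ γ v → Dec (Done γ v))
    (coloured⇒done : ∀ {γ v} → γ v ≡ e → Done γ v)
    (done-stable : ∀ {γ δ v} {r : Redicolouring D γ δ} → RecoloursTo S e r → Done γ v → Done δ v)
    (inv-recolour : ∀ {γ v} → S v → Inv γ → Inv (recolour γ v e))
    (dicolouring-recolour : ∀ {γ v} → IsDicolouring D γ → Inv γ → S v → ¬ Done γ v →
                            IsDicolouring D (recolour γ v e))
    where

    record GreedyResult (vs : List (Fin n)) (γ : Col) : Set where
      field
        target    : Col
        sequence  : Redicolouring D γ target
        recolours : RecoloursTo S e sequence
        finished  : ∀ v → v ∈ₗ vs → S v → Done target v

    open GreedyResult public

    skip : ∀ {v vs γ} → GreedyResult vs γ → (S v → Done γ v) → GreedyResult (v ∷ vs) γ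
    skip R done-v = record
      { target    = target R
      ; sequence  = sequence R
      ; recolours = recolours R
      ; finished  = λ { _ (here refl) Sv → done-stable (recolours R) (done-v Sv) ; w (there w∈) → finished R w w∈ }
      }

    greedy : ∀ vs γ → IsDicolouring D γ → Inv γ → GreedyResult vs γ
    greedy [] γ _ _ = record { target = γ ; sequence = done ; recolours = stay ; finished = λ _ () }
    greedy (v ∷ vs) γ dic inv with S? v | done? γ v
    ... | no ¬Sv | _           = skip (greedy vs γ dic inv) (λ Sv → contradiction Sv ¬Sv)
    ... | yes _  | yes done-v  = skip (greedy vs γ dic inv) (λ _ → done-v)
    ... | yes Sv | no  ¬done-v = prepend (greedy vs γ′ dic′ (inv-recolour Sv inv))
      where
      γ′ = recolour γ v e
      dic′ = dicolouring-recolour dic inv Sv ¬done-v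
      prepend : GreedyResult vs γ′ → GreedyResult (v ∷ vs) γ
      prepend R = record
        { target    = target R
        ; sequence  = step (recolour-oneStep γ v e (¬done-v ∘ coloured⇒done)) dic′ (sequence R)
        ; recolours = move Sv (recolour-same γ v e) (recolours R)
        ; finished  = λ { _ (here refl) _ → done-stable (recolours R) (coloured⇒done (recolour-same γ v e))
                        ; w (there w∈) → finished R w w∈ }
        }

module Levels {n k : ℕ} (D : Digraph n) (p : Fin n → ℕ) where
  open Sequences {n} {k} D

  private
    variable
      s h : ℕ
      Z : Fin n → Set
      γ : Col

  Active : (Fin n → Set) → ℕ → Fin n → Set
  Active Z h v = ¬ Z v × p v < h

  record CycleTransversal (s : ℕ) (Z : Fin n → Set) (u : Fin n) (X : List (Fin n)) : Set where
    field
      size  : length X ≤ s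
      above : All (λ x → p u < p x) X
      hits  : ∀ C → IsDirCycle D C → u ∈ₗ C → All (λ w → p u ≤ p w) C → All (λ w → ¬ Z w) C →
              Any (_∈ₗ X) C

  open CycleTransversal

  Transversals : ℕ → ℕ → (Fin n → Set) → (Fin n → List (Fin n)) → Set
  Transversals s h Z X = ∀ u → Active Z h u → CycleTransversal s Z u (X u)

  Frozen : (Fin n → Set) → List (Fin k) → Col → Set
  Frozen Z ps γ = ∀ z → Z z → ¬ (γ z ∈ₗ ps)

  frozen-⊆ : ∀ {ps qs} → qs ⊆ ps → Frozen Z ps γ → Frozen Z qs γ
  frozen-⊆ qs⊆ps fr z Zz = fr z Zz ∘ qs⊆ps

  frozen-fixed : ∀ {ps δ} → (∀ z → Z z → δ z ≡ γ z) → Frozen Z ps γ → Frozen Z ps δ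
  frozen-fixed {ps = ps} fixed fr z Zz = fr z Zz ∘ subst (_∈ₗ ps) (fixed z Zz)

  frozen-along : ∀ {ps α β} (r : Redicolouring D α β) → (∀ z → Z z → recolourings z r ≡ 0) →
                 Frozen Z ps α → Frozen Z ps β
  frozen-along r unrecoloured = frozen-fixed (λ z Zz → recolourings≡0⇒fixed z r (unrecoloured z Zz))

  frozen-recoloursTo : ∀ {ps S e α β} {r : Redicolouring D α β} → (∀ v → S v → ¬ Z v) →
                       RecoloursTo S e r → Frozen Z ps α → Frozen Z ps β
  frozen-recoloursTo {Z = Z} {r = r} S⇒¬Z m =
    frozen-along r (λ z Zz → recoloursTo-outside z m (λ Sz → S⇒¬Z z Sz Zz))

  unfrozen-on-cycle : ∀ {ps e u C} → Frozen Z ps γ → e ∈ₗ ps → ¬ Z u →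
                      All (λ w → w ≢ u → γ w ≡ e) C → All (λ w → ¬ Z w) C
  unfrozen-on-cycle {Z = Z} {ps = ps} {u = u} fr e∈ps ¬Zu = All.map unfrozen
    where
    unfrozen : ∀ {w} → (w ≢ u → _ ≡ _) → ¬ Z w
    unfrozen {w} mono Zw with w ≟ u
    ... | yes refl = ¬Zu Zw
    ... | no  w≢u  = fr w Zw (subst (_∈ₗ ps) (sym (mono w≢u)) e∈ps)

  lowest : ∀ x xs → ∃ λ w → w ∈ₗ x ∷ xs × All (λ y → p w ≤ p y) (x ∷ xs)
  lowest x xs = argmin p x xs , argmin∈ (argmin-sel p x xs) ,
                (f[argmin]≤f[⊤] {f = p} x xs ∷ f[argmin]≤f[xs] {f = p} x xs)
    where
    argmin∈ : argmin p x xs ≡ x ⊎ argmin p x xs ∈ₗ xs → argmin p x xs ∈ₗ x ∷ xs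
    argmin∈ = [ here , there ]

  -- Apply the transversal property at the lowest vertex of the cycle.
  no-unfrozen-cycle : ∀ {X} → Transversals 0 h Z X → ∀ {C} → IsDirCycle D C → All (λ w → ¬ Z w) C →
                      Any (λ w → p w < h) C → ⊥
  no-unfrozen-cycle {X = X} X-tr {x ∷ xs} cycle unfrozen low with lowest x xs | find low
  ... | w , w∈C , w-lowest | v , v∈C , pv<h =
    let T = X-tr w (All.lookup unfrozen w∈C , ≤-<-trans (All.lookup w-lowest v∈C) pv<h)
        _ , _ , y∈X = find (hits T (x ∷ xs) cycle w∈C w-lowest unfrozen)
    in <⇒≱ (∈-length y∈X) (size T)

  active? : Decidable Z → ∀ h → Decidable (Active Z h)
  active? Z? h v = ¬? (Z? v) ×-dec (p v <? h)

  frozen-recolour : ∀ {ps v e} → ¬ Z v → Frozen Z ps γ → Frozen Z ps (recolour γ v e)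
  frozen-recolour {Z = Z} {γ = γ} {v = v} {e} ¬Zv =
    frozen-fixed (λ z Zz → recolour-other γ v e (λ z≡v → ¬Zv (subst Z z≡v Zz)))

  -- ps is the palette without the colour to be avoided.
  record AvoidingSequence (s h : ℕ) (Z : Fin n → Set) (ps : List (Fin k)) (α : Col) : Set where
    field
      target   : Col
      sequence : Redicolouring D α target
      avoids   : ∀ v → Active Z h v → target v ∈ₗ ps
      fixes    : ∀ v → ¬ Active Z h v → recolourings v sequence ≡ 0
      bounded  : ∀ v → recolourings v sequence ≤ recolourBound s h

  open AvoidingSequence

  AvoidingSequences : ℕ → ℕ → Fin k → List (Fin k) → Set₁
  AvoidingSequences s h c ps = ∀ {Z X α} → Decidable Z → Transversals s h Z X →
    IsDicolouring D α → Frozen Z (c ∷ ps) α → AvoidingSequence s h Z ps α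

  avoidingSequence-base : ∀ {c e} → AvoidingSequences 0 h c (e ∷ [])
  avoidingSequence-base {h = h} {c = c} {e = e} {Z = Z} {α = α} Z? X-tr dic fr = record
    { target   = target R
    ; sequence = sequence R
    ; avoids   = λ v a → here (finished R v (∈-allFin v) a)
    ; fixes    = λ v ¬a → recoloursTo-outside v (recolours R) ¬a
    ; bounded  = λ v → recoloursTo-≤1 v (recolours R)
    }
    where
    safe : ∀ {γ v} → IsDicolouring D γ → Frozen Z (c ∷ e ∷ []) γ → Active Z h v → γ v ≢ e →
           IsDicolouring D (recolour γ v e)
    safe {γ} {v} dic fr (¬Zv , pv<h) _ = recolour-isDicolouring γ v e dic λ C cycle v∈C mono →
      no-unfrozen-cycle X-tr cycle (unfrozen-on-cycle fr (there (here refl)) ¬Zv mono) (lose v∈C pv<h)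
    open Greedy e (active? Z? h) (Frozen Z (c ∷ e ∷ [])) (λ γ v → γ v ≡ e) (λ γ v → γ v ≟ e)
                (λ eq → eq) (λ {_} {_} {v} m → recoloursTo-keeps-e v m) (frozen-recolour ∘ proj₁) safe
    R : GreedyResult (allFin n) α
    R = greedy (allFin n) α dic fr

  Blocked : Fin k → (Fin n → List (Fin n)) → Col → Fin n → Set
  Blocked d X γ u = γ u ≡ d ⊎ Any (λ x → γ x ≡ d) (X u)

  module Blocking {s h : ℕ} {Z : Fin n → Set} (Z? : Decidable Z) {ps : List (Fin k)} {d : Fin k}
                  (d∈ps : d ∈ₗ ps) {X : Fin n → List (Fin n)} (X-tr : Transversals s h Z X) where

    NoneBelow : ℕ → Col → Set
    NoneBelow ℓ γ = ∀ w → Active Z ℓ w → γ w ≢ d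

    OnLevel : ℕ → Fin n → Set
    OnLevel ℓ v = ¬ Z v × p v ≡ ℓ

    onLevel? : ∀ ℓ → Decidable (OnLevel ℓ)
    onLevel? ℓ v = ¬? (Z? v) ×-dec (p v ≟ℕ ℓ)

    blocked? : ∀ γ u → Dec (Blocked d X γ u)
    blocked? γ u = (γ u ≟ d) ⊎-dec Any.any? (λ x → γ x ≟ d) (X u)

    blocked-stable : ∀ {S γ δ u} {r : Redicolouring D γ δ} → RecoloursTo S d r →
                     Blocked d X γ u → Blocked d X δ u
    blocked-stable m (inj₁ γu≡d) = inj₁ (recoloursTo-keeps-e _ m γu≡d)
    blocked-stable m (inj₂ hit)  = inj₂ (Any.map (recoloursTo-keeps-e _ m) hit)

    recolour-unblocked : ∀ {ℓ γ v} → ℓ < h → IsDicolouring D γ → Frozen Z ps γ × NoneBelow ℓ γ →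
                         OnLevel ℓ v → ¬ Blocked d X γ v → IsDicolouring D (recolour γ v d)
    recolour-unblocked {γ = γ} {v} ℓ<h dic (fr , none) (¬Zv , refl) unblocked =
      recolour-isDicolouring γ v d dic no-cycle
      where
      no-cycle : ∀ C → IsDirCycle D C → v ∈ₗ C → All (λ w → w ≢ v → γ w ≡ d) C → ⊥
      no-cycle C cycle v∈C mono with All.all? (λ w → p v ≤? p w) C
      ... | yes high = unblocked (inj₂ (lose y∈X (All.lookup mono y∈C y≢v)))
        where
        T = X-tr v (¬Zv , ℓ<h)
        found = find (hits T C cycle v∈C high (unfrozen-on-cycle fr d∈ps ¬Zv mono))
        y = proj₁ found
        y∈C = proj₁ (proj₂ found)
        y∈X = proj₂ (proj₂ found)
        y≢v : y ≢ v
        y≢v y≡v = <-irrefl (cong p (sym y≡v)) (All.lookup (above T) y∈X)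
      ... | no ¬high = none y (All.lookup (unfrozen-on-cycle fr d∈ps ¬Zv mono) y∈C , py<pv)
                            (All.lookup mono y∈C (λ y≡v → <-irrefl (cong p y≡v) py<pv))
        where
        found = find (¬All⇒Any¬ (λ w → p v ≤? p w) C ¬high)
        y = proj₁ found
        y∈C = proj₁ (proj₂ found)
        py<pv = ≰⇒> (proj₂ (proj₂ found))

    record BlockingSequence (m : ℕ) (γ : Col) : Set where
      field
        target    : Col
        sequence  : Redicolouring D γ target
        recolours : RecoloursTo (Active Z m) d sequence
        blocked   : ∀ u → Active Z m u → Blocked d X target u

    -- Levels are processed from m - 1 down to 0, so that no vertex below the
    -- current level has colour d yet.
    blockBelow : ∀ m → m ≤ h → ∀ γ → IsDicolouring D γ → Frozen Z ps γ → NoneBelow (pred m) γ →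
                 BlockingSequence m γ
    blockBelow zero _ γ _ _ _ = record { target = γ ; sequence = done ; recolours = stay ; blocked = λ _ () }
    blockBelow (suc ℓ) ℓ<h γ dic fr none = record
      { target    = B.target
      ; sequence  = L.sequence ◅◅ B.sequence
      ; recolours = recoloursTo-◅◅
          (recoloursTo-mono (λ _ (¬Zw , pw≡ℓ) → ¬Zw , ≤-reflexive (cong suc pw≡ℓ)) L.recolours)
          (recoloursTo-mono (λ _ (¬Zw , pw<ℓ) → ¬Zw , m<n⇒m<1+n pw<ℓ) B.recolours)
      ; blocked   = blocked′
      }
      where
      inv-recolour : ∀ {γ v} → OnLevel ℓ v → Frozen Z ps γ × NoneBelow ℓ γ →
                     Frozen Z ps (recolour γ v d) × NoneBelow ℓ (recolour γ v d)
      inv-recolour {γ} {v} (¬Zv , refl) (fr , none) =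
        frozen-recolour ¬Zv fr ,
        λ w (¬Zw , pw<pv) → subst (_≢ d) (sym (recolour-other γ v d (λ { refl → <-irrefl refl pw<pv })))
                                  (none w (¬Zw , pw<pv))
      open Greedy d (onLevel? ℓ) (λ γ → Frozen Z ps γ × NoneBelow ℓ γ) (Blocked d X) blocked? inj₁
                  blocked-stable inv-recolour (recolour-unblocked ℓ<h)
      module L = GreedyResult (greedy (allFin n) γ dic (fr , none))
      untouched : ∀ {w} → ¬ OnLevel ℓ w → L.target w ≡ γ w
      untouched {w} = recoloursTo-fixed-outside w L.recolours
      fr₁ : Frozen Z ps L.target
      fr₁ = frozen-recoloursTo (λ _ → proj₁) L.recolours fr
      none₁ : NoneBelow (pred ℓ) L.target
      none₁ w (¬Zw , pw<) =
        subst (_≢ d) (sym (untouched (λ (_ , pw≡ℓ) → <-irrefl pw≡ℓ pw<ℓ))) (none w (¬Zw , pw<ℓ))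
        where pw<ℓ = <-≤-trans pw< pred[n]≤n
      module B = BlockingSequence (blockBelow ℓ (<⇒≤ ℓ<h) L.target (end-isDicolouring dic L.sequence) fr₁ none₁)
      blocked′ : ∀ u → Active Z (suc ℓ) u → Blocked d X B.target u
      blocked′ u (¬Zu , pu<) with p u ≟ℕ ℓ
      ... | yes pu≡ℓ = blocked-stable B.recolours (L.finished u (∈-allFin u) (¬Zu , pu≡ℓ))
      ... | no  pu≢ℓ = B.blocked u (¬Zu , ≤∧≢⇒< (≤-pred pu<) pu≢ℓ)

  toList-transversals :
    (∀ u → p u < h → ∃ λ (X : Subset n) → ∣ X ∣ ≤ s × (∀ w → w ∈ X → p u < p w)
       × (∀ C → IsDirCycle D C → u ∈ₗ C → All (λ w → p u ≤ p w) C → Any (_∈ X) C)) →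
    ∃ λ X → Transversals s h Z X
  toList-transversals {h = h} {s = s} {Z = Z} hyp = X , X-tr
    where
    X : Fin n → List (Fin n)
    X u with p u <? h
    ... | yes pu<h = toList (proj₁ (hyp u pu<h))
    ... | no  _    = []
    X-tr : Transversals s h Z X
    X-tr u (_ , pu<h) with p u <? h
    ... | no ¬pu<h  = contradiction pu<h ¬pu<h
    ... | yes pu<h′ with hyp u pu<h′
    ...   | X′ , size≤s , above-u , hits-u = record
      { size  = subst (_≤ s) (sym (length-toList X′)) size≤s
      ; above = All.tabulate (λ x∈ → above-u _ (∈-toList⁻ X′ x∈))
      ; hits  = λ C cycle u∈C high _ → Any.map (∈-toList⁺ X′) (hits-u C cycle u∈C high)
      }

  FrozenWith : (Fin n → Set) → Col → Fin k → Fin n → Set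
  FrozenWith Z γ d v = Z v ⊎ γ v ≡ d

  -- Every active u is blocked and not coloured d, so X u loses a vertex coloured d.
  transversals-shrink : ∀ {X d} (Z? : Decidable Z) → Transversals (suc s) h Z X →
    (∀ u → Active Z h u → Blocked d X γ u) →
    Transversals s h (FrozenWith Z γ d) (λ u → filter (λ x → ¬? (Z? x ⊎-dec (γ x ≟ d))) (X u))
  transversals-shrink {γ = γ} {X = X} {d} Z? X-tr blocked u (¬Z′u , pu<h) = record
    { size  = ≤-pred (<-≤-trans
                (filter-notAll unfrozen? (X u) (Any.map (λ γx≡d ¬Z′x → ¬Z′x (inj₂ γx≡d)) hit)) (size T))
    ; above = AllP.filter⁺ unfrozen? (above T)
    ; hits  = λ C cycle u∈C high unfrozen →
        let y , y∈C , y∈X = find (hits T C cycle u∈C high (All.map (λ ¬Z′w → ¬Z′w ∘ inj₁) unfrozen))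
        in lose y∈C (∈-filter⁺ unfrozen? y∈X (All.lookup unfrozen y∈C))
    }
    where
    unfrozen? = λ x → ¬? (Z? x ⊎-dec (γ x ≟ d))
    T = X-tr u (¬Z′u ∘ inj₁ , pu<h)
    hit : Any (λ x → γ x ≡ d) (X u)
    hit = [ (λ γu≡d → contradiction (inj₂ γu≡d) ¬Z′u) , (λ hit → hit) ]
            (blocked u (¬Z′u ∘ inj₁ , pu<h))

  avoidingSequence-freeze : ∀ {c d ps X} → ¬ d ∈ₗ c ∷ ps → AvoidingSequences s h c ps → Decidable Z →
    Transversals (suc s) h Z X → IsDicolouring D γ → Frozen Z (c ∷ ps) γ →
    (∀ u → Active Z h u → Blocked d X γ u) → AvoidingSequence s h Z (d ∷ ps) γ
  avoidingSequence-freeze {s = s} {h = h} {Z = Z} {γ = γ} {c} {d} {ps} d∉c∷ps recurse Z? X-tr dic fr blocked = record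
    { target   = target R
    ; sequence = sequence R
    ; avoids   = avoids′
    ; fixes    = λ v ¬a → fixes R v (λ (¬Z′v , pv<h) → ¬a (¬Z′v ∘ inj₁ , pv<h))
    ; bounded  = bounded R
    }
    where
    fr′ : Frozen (FrozenWith Z γ d) (c ∷ ps) γ
    fr′ z (inj₁ Zz)   = fr z Zz
    fr′ z (inj₂ γz≡d) = d∉c∷ps ∘ subst (_∈ₗ c ∷ ps) γz≡d
    R : AvoidingSequence s h (FrozenWith Z γ d) ps γ
    R = recurse (λ v → Z? v ⊎-dec (γ v ≟ d)) (transversals-shrink Z? X-tr blocked) dic fr′
    avoids′ : ∀ v → Active Z h v → target R v ∈ₗ d ∷ ps
    avoids′ v (¬Zv , pv<h) with γ v ≟ d
    ... | yes γv≡d =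
      here (trans (recolourings≡0⇒fixed v (sequence R) (fixes R v (λ a → proj₁ a (inj₂ γv≡d)))) γv≡d)
    ... | no  γv≢d = there (avoids R v ([ ¬Zv , γv≢d ] , pv<h))

  avoidingSequence-step : ∀ {c d ps} → Unique (c ∷ d ∷ ps) → AvoidingSequences (suc s) h d (c ∷ ps) →
    AvoidingSequences s (suc h) c ps → AvoidingSequences (suc s) (suc h) c (d ∷ ps)
  avoidingSequence-step {s = s} {h = h} {c} {d} {ps} ((c≢d ∷ _) ∷ (d∉ps ∷ _)) recurse₁ recurse₃ {Z} {α = α}
                        Z? X-tr dic fr = record
    { target   = target phase₃
    ; sequence = (sequence phase₁ ◅◅ phase₂.sequence) ◅◅ sequence phase₃
    ; avoids   = avoids phase₃
    ; fixes    = λ v ¬a → trans (recolourings-◅◅◅ v (sequence phase₁) phase₂.sequence (sequence phase₃))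
        (cong₂ _+_ (cong₂ _+_ (fixes phase₁ v (λ (¬Zv , pv<h) → ¬a (¬Zv , m<n⇒m<1+n pv<h)))
                              (recoloursTo-outside v phase₂.recolours ¬a))
                   (fixes phase₃ v ¬a))
    ; bounded  = λ v → subst (_≤ recolourBound (suc s) (suc h))
        (sym (recolourings-◅◅◅ v (sequence phase₁) phase₂.sequence (sequence phase₃)))
        (+-mono-≤ (+-mono-≤ (bounded phase₁ v) (recoloursTo-≤1 v phase₂.recolours)) (bounded phase₃ v))
    }
    where
    d∉c∷ps : ¬ d ∈ₗ c ∷ ps
    d∉c∷ps = All¬⇒¬Any ((c≢d ∘ sym) ∷ d∉ps)
    phase₁ : AvoidingSequence (suc s) h Z (c ∷ ps) α
    phase₁ = recurse₁ Z? (λ u (¬Zu , pu<h) → X-tr u (¬Zu , m<n⇒m<1+n pu<h)) dic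
                      (frozen-⊆ (∈-resp-↭ (↭-swap d c ↭-refl)) fr)
    fr₁ : Frozen Z (c ∷ d ∷ ps) (target phase₁)
    fr₁ = frozen-along (sequence phase₁) (λ z Zz → fixes phase₁ z (λ a → proj₁ a Zz)) fr
    module Block = Blocking Z? (there (here refl)) X-tr
    none₁ : Block.NoneBelow h (target phase₁)
    none₁ w a γ₁w≡d = d∉c∷ps (subst (_∈ₗ c ∷ ps) γ₁w≡d (avoids phase₁ w a))
    dic₁ : IsDicolouring D (target phase₁)
    dic₁ = end-isDicolouring dic (sequence phase₁)
    module phase₂ = Block.BlockingSequence (Block.blockBelow (suc h) ≤-refl (target phase₁) dic₁ fr₁ none₁)
    fr₂ : Frozen Z (c ∷ ps) phase₂.target
    fr₂ = frozen-⊆ (∷⁺ʳ c (xs⊆x∷xs ps d)) (frozen-recoloursTo (λ _ → proj₁) phase₂.recolours fr₁)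
    phase₃ : AvoidingSequence s (suc h) Z (d ∷ ps) phase₂.target
    phase₃ = avoidingSequence-freeze d∉c∷ps recurse₃ Z? X-tr (end-isDicolouring dic₁ phase₂.sequence) fr₂
                                     phase₂.blocked

  avoidingSequence : ∀ s h {c ps} → Unique (c ∷ ps) → length ps ≡ suc s → AvoidingSequences s h c ps
  avoidingSequence zero h {ps = _ ∷ []} _ refl = avoidingSequence-base
  avoidingSequence (suc s) zero _ _ {α = α} _ _ _ _ = record
    { target = α ; sequence = done ; avoids = λ { _ (_ , ()) } ; fixes = λ _ _ → refl ; bounded = λ _ → z≤n }
  avoidingSequence (suc s) (suc h) {c} {d ∷ ps} uq@((c≢d ∷ c∉ps) ∷ (d∉ps ∷ uq′)) len =
    avoidingSequence-step uq (avoidingSequence (suc s) h (((c≢d ∘ sym) ∷ d∉ps) ∷ (c∉ps ∷ uq′)) len)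
                             (avoidingSequence s (suc h) (c∉ps ∷ uq′) (suc-injective len))

lemma27 : ∀ {n} (D : Digraph n) (t : ℕ) (part : Fin n → Fin t)
    → (∀ (i : Fin t) → ∃ λ (v : Fin n) → part v ≡ i)
    → (s k : ℕ) → suc (suc s) ≤ k
    → (h : ℕ) → 1 ≤ h → h ≤ t
    → (∀ (u : Fin n) → toℕ (part u) < h →
         ∃ λ (X : Subset n) →
           ∣ X ∣ ≤ s
           × (∀ w → w ∈ X → toℕ (part u) < toℕ (part w))
           × (∀ (C : List (Fin n)) → IsDirCycle D C → u ∈ₗ C
                → All (λ w → toℕ (part u) ≤ toℕ (part w)) C
                → Any (λ w → w ∈ X) C))
    → ∀ (α : Colouring n k) → IsDicolouring D α
    → ∀ (c : Fin k) → toℕ c < suc (suc s)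
    → ∃ λ (β : Colouring n k) → Σ (Redicolouring D α β) λ seq →
        (∀ v → toℕ (part v) < h → β v ≢ c × toℕ (β v) < suc (suc s))
        × (∀ v → h ≤ toℕ (part v) → recolourings v seq ≡ 0)
        × (∀ v → toℕ (part v) < h → recolourings v seq ≤ f s h)
-- The construction works for every h.
lemma27 D t part _ s k s+2≤k h _ _ hyp α dic c c<s+2 =
  target , sequence ,
  (λ v pv<h → let β-v∈ps = avoids v ((λ ()) , pv<h) in
     (λ β-v≡c → c∉ps (subst (_∈ₗ ps) β-v≡c β-v∈ps)) , otherColours-< s+2≤k c c<s+2 β-v∈ps) ,
  (λ v h≤pv → fixes v (λ (_ , pv<h) → <⇒≱ pv<h h≤pv)) ,
  (λ v _ → ≤-trans (bounded v) (recolourBound≤f s h))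
  where
  open Levels {k = k} D (toℕ ∘ part)
  ps : List (Fin k)
  ps = otherColours s+2≤k c c<s+2
  palette-unique : Unique (c ∷ ps)
  palette-unique = otherColours-unique s+2≤k c c<s+2
  c∉ps : ¬ c ∈ₗ ps
  c∉ps = All¬⇒¬Any (AllPairs.head palette-unique)
  open AvoidingSequence
    (avoidingSequence s h palette-unique (length-otherColours s+2≤k c c<s+2)
                      (λ _ → no (λ ())) (proj₂ (toList-transversals {Z = λ _ → ⊥} hyp)) dic (λ _ ()))
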